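{- Let $\Delta^{\mathcal T}_{\mathcal R}$ be any of the ten systems $\Delta^{\rm CD}_{\equiv},\Delta^{\rm CDV}_{\equiv},\Delta^{\rm CDS}_{\equiv},\Delta^{\rm BCD}_{\equiv},\Delta^{\rm CD}_{=_\beta},\Delta^{\rm CDV}_{=_\beta},\Delta^{\rm CDS}_{=_\beta},\Delta^{\rm BCD}_{=_\beta},\Delta^{\rm CDV}_{=_{\beta\eta}},\Delta^{\rm BCD}_{=_{\beta\eta}}$. For every strongly normalizing pure $\lambda$-term $M$ there exist a basis $B$, a type $\sigma$ and a $\Delta$-term $\Delta$ such that $\lfloor\Delta\rfloor\equiv M$ and $B\vdash^{\mathcal T}_{\mathcal R}\Delta:\sigma$.
   Context: Types: $\mathbb A_\infty=\{a_i\mid i\in\mathbb N\}$, $\omega$ special atom, $\mathbb A^\omega_\infty=\mathbb A_\infty\cup\{\omega\}$; types $\sigma::=\mathbb A\mid\sigma\to\sigma\mid\sigma\cap\sigma$. Minimal type theory: (refl), (incl) $\sigma\cap\tau\le\sigma,\sigma\cap\tau\le\tau$, (glb) $\rho\le\sigma,\rho\le\tau\Rightarrow\rho\le\sigma\cap\tau$, (trans). Extras: $(\omega_{top})$ $\sigma\le\omega$; $(\omega_\to)$ $\omega\le\sigma\to\omega$; $(\to\cap)$ $(\sigma\to\tau)\cap(\sigma\to\rho)\le\sigma\to\tau\cap\rho$; $(\to)$ $\sigma_2\le\sigma_1,\tau_1\le\tau_2\Rightarrow\sigma_1\to\tau_1\le\sigma_2\to\tau_2$. $\mathcal T_{\rm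 CD}$: over $\mathbb A_\infty$, minimal; $\mathcal T_{\rm CDS}$: over $\mathbb A^\omega_\infty$ plus $(\omega_{top})$; $\mathcal T_{\rm CDV}$: over $\mathbb A_\infty$ plus $(\to),(\to\cap)$; $\mathcal T_{\rm BCD}$: over $\mathbb A^\omega_\infty$ plus all four extras. $\Delta$-terms: $\Delta::=u_\Delta\mid x\mid\lambda x{:}\sigma.\Delta\mid\Delta\,\Delta\mid\langle\Delta,\Delta\rangle\mid pr_i\Delta\mid\Delta^\sigma$, $u_\Delta$ a constant indexed by an arbitrary $\Delta$-term. Essence: $\lfloor x\rfloor=x$, $\lfloor u_\Delta\rfloor=\lfloor\Delta\rfloor$, $\lfloor\Delta^\sigma\rfloor=\lfloor\Delta\rfloor$, $\lfloor\lambda x{:}\sigma.\Delta\rfloor=\lambda x.\lfloor\Delta\rfloor$, $\lfloor\Delta_1\Delta_2\rfloor=\lfloor\Delta_1\rfloor\lfloor\Delta_2\rfloor$, $\lfloor\langle\Delta_1,\Delta_2\rangle\rfloor=\lfloor\Delta_1\rfloor$, $\lfloor pr_i\Delta\rfloor=\lfloor\Delta\rfloor$. Typed system $\Delta^{\mathcal T}_{\mathcal R}$ ($\mathcal R\in\{\equiv,=_\beta,=_{\beta\eta}\}$): (top) $B\vdash u_\Delta:\omega$ if $\omega$ is an atom of $\mathcal T$; (ax) $B\vdash x:\sigma$ if $x{:}\sigma\in B$; ($\to I$) $B,x{:}\sigma\vdash\Delta:\tau\Rightarrow B\vdash\lambda x{:}\sigma.\Delta:\sigma\to\tau$; ($\to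 E$); ($\cap I$) from $B\vdash\Delta_1:\sigma$, $B\vdash\Delta_2:\tau$, $\lfloor\Delta_1\rfloor\mathcal R\lfloor\Delta_2\rfloor$ get $B\vdash\langle\Delta_1,\Delta_2\rangle:\sigma\cap\tau$; ($\cap E_i$) from $\Delta:\sigma\cap\tau$ get $pr_1\Delta:\sigma$, $pr_2\Delta:\tau$; ($\le_{\mathcal T}$) from $\Delta:\sigma$, $\sigma\le_{\mathcal T}\tau$ get $\Delta^\tau:\tau$. -}

module Defs where

open import Data.Nat using (ℕ; zero; suc)
open import Data.List using (List; []; _∷_)
open import Data.Product using (Σ; _×_; _,_; ∃-syntax)
open import Relation.Binary.PropositionalEquality using (_≡_)
open import Induction.WellFounded using (Acc)

-- Pure λ-terms (de Bruijn indices; syntactic identity ≡ is α-equivalence)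

data Λ : Set where
  var : ℕ → Λ
  ƛ_  : Λ → Λ
  _·_ : Λ → Λ → Λ

infixl 7 _·_
infix 9 _[_]
infix 4 _→β_ _→βη_ _=β_ _=βη_
infix 5 ƛ_

ext : (ℕ → ℕ) → ℕ → ℕ
ext ρ zero    = zero
ext ρ (suc i) = suc (ρ i)

rename : (ℕ → ℕ) → Λ → Λ
rename ρ (var i) = var (ρ i)
rename ρ (ƛ M)   = ƛ rename (ext ρ) M
rename ρ (M · N) = rename ρ M · rename ρ N

exts : (ℕ → Λ) → ℕ → Λ
exts s zero    = var zero
exts s (suc i) = rename suc (s i)

subst : (ℕ → Λ) → Λ → Λ
subst s (var i) = s i
subst s (ƛ M)   = ƛ subst (exts s) M
subst s (M · N) = subst s M · subst s N

subst-zero : Λ → ℕ → Λ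
subst-zero N zero    = N
subst-zero N (suc i) = var i

_[_] : Λ → Λ → Λ
M [ N ] = subst (subst-zero N) M

data _→β_ : Λ → Λ → Set where
  β    : ∀ {M N} → (ƛ M) · N →β M [ N ]
  ξ-ƛ  : ∀ {M M'} → M →β M' → ƛ M →β ƛ M'
  ξ-·₁ : ∀ {M M' N} → M →β M' → M · N →β M' · N
  ξ-·₂ : ∀ {M N N'} → N →β N' → M · N →β M · N'

data _→βη_ : Λ → Λ → Set where
  β    : ∀ {M N} → (ƛ M) · N →βη M [ N ]
  η    : ∀ {M} → ƛ (rename suc M · var zero) →βη M
  ξ-ƛ  : ∀ {M M'} → M →βη M' → ƛ M →βη ƛ M'
  ξ-·₁ : ∀ {M M' N} → M →βη M' → M · N →βη M' · N
  ξ-·₂ : ∀ {M N N'} → N →βη N' → M · N →βη M · N'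

data Conv (S : Λ → Λ → Set) : Λ → Λ → Set where
  step  : ∀ {M N} → S M N → Conv S M N
  refl  : ∀ {M} → Conv S M M
  sym   : ∀ {M N} → Conv S M N → Conv S N M
  trans : ∀ {M N P} → Conv S M N → Conv S N P → Conv S M P

_=β_ : Λ → Λ → Set
_=β_ = Conv _→β_

_=βη_ : Λ → Λ → Set
_=βη_ = Conv _→βη_

SN : Λ → Set
SN = Acc (λ N M → M →β N)

data Theory : Set where
  CD CDV CDS BCD : Theory

data HasΩ : Theory → Set where
  cds : HasΩ CDS
  bcd : HasΩ BCD

instance
  hasΩ-CDS : HasΩ CDS
  hasΩ-CDS = cds
  hasΩ-BCD : HasΩ BCD
  hasΩ-BCD = bcd

data HasArrow : Theory → Set where
  cdv : HasArrow CDV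
  bcd : HasArrow BCD

data Type (T : Theory) : Set where
  atom : ℕ → Type T
  ω    : ⦃ HasΩ T ⦄ → Type T
  _⇒_  : Type T → Type T → Type T
  _∩_  : Type T → Type T → Type T

infixr 6 _⇒_
infixl 7 _∩_
infix 4 _⊢_≤_

data _⊢_≤_ : (T : Theory) → Type T → Type T → Set where
  ≤-refl  : ∀ {T σ} → T ⊢ σ ≤ σ
  ≤-incl₁ : ∀ {T σ τ} → T ⊢ σ ∩ τ ≤ σ
  ≤-incl₂ : ∀ {T σ τ} → T ⊢ σ ∩ τ ≤ τ
  ≤-glb   : ∀ {T ρ σ τ} → T ⊢ ρ ≤ σ → T ⊢ ρ ≤ τ → T ⊢ ρ ≤ σ ∩ τ
  ≤-trans : ∀ {T σ τ ρ} → T ⊢ σ ≤ τ → T ⊢ τ ≤ ρ → T ⊢ σ ≤ ρ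
  ≤-ωtop  : ∀ {T} ⦃ h : HasΩ T ⦄ {σ : Type T} → T ⊢ σ ≤ ω
  ≤-ω→    : ∀ {σ : Type BCD} → BCD ⊢ ω ≤ σ ⇒ ω
  ≤-→∩    : ∀ {T} → HasArrow T → ∀ {σ τ ρ : Type T} →
            T ⊢ (σ ⇒ τ) ∩ (σ ⇒ ρ) ≤ σ ⇒ (τ ∩ ρ)
  ≤-→     : ∀ {T} → HasArrow T → ∀ {σ₁ σ₂ τ₁ τ₂ : Type T} →
            T ⊢ σ₂ ≤ σ₁ → T ⊢ τ₁ ≤ τ₂ → T ⊢ σ₁ ⇒ τ₁ ≤ σ₂ ⇒ τ₂

data ΔTerm (T : Theory) : Set where
  u    : ΔTerm T → ΔTerm T
  var  : ℕ → ΔTerm T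
  lam  : Type T → ΔTerm T → ΔTerm T
  _·_  : ΔTerm T → ΔTerm T → ΔTerm T
  ⟨_,_⟩ : ΔTerm T → ΔTerm T → ΔTerm T
  pr₁  : ΔTerm T → ΔTerm T
  pr₂  : ΔTerm T → ΔTerm T
  _^_  : ΔTerm T → Type T → ΔTerm T

⌊_⌋ : ∀ {T} → ΔTerm T → Λ
⌊ u Δ ⌋         = ⌊ Δ ⌋
⌊ var i ⌋       = var i
⌊ lam σ Δ ⌋     = ƛ ⌊ Δ ⌋
⌊ Δ₁ · Δ₂ ⌋     = ⌊ Δ₁ ⌋ · ⌊ Δ₂ ⌋
⌊ ⟨ Δ₁ , Δ₂ ⟩ ⌋ = ⌊ Δ₁ ⌋
⌊ pr₁ Δ ⌋       = ⌊ Δ ⌋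
⌊ pr₂ Δ ⌋       = ⌊ Δ ⌋
⌊ Δ ^ σ ⌋       = ⌊ Δ ⌋

data Rel : Set where
  ≡R βR βηR : Rel

⟦_⟧R : Rel → Λ → Λ → Set
⟦ ≡R ⟧R  = _≡_
⟦ βR ⟧R  = _=β_
⟦ βηR ⟧R = _=βη_

data System : Theory → Rel → Set where
  CD-≡    : System CD  ≡R
  CDV-≡   : System CDV ≡R
  CDS-≡   : System CDS ≡R
  BCD-≡   : System BCD ≡R
  CD-β    : System CD  βR
  CDV-β   : System CDV βR
  CDS-β   : System CDS βR
  BCD-β   : System BCD βR
  CDV-βη  : System CDV βηR
  BCD-βη  : System BCD βηR

-- Typing; a basis is a list of types, the i-th entry typing variable i

infix 4 _∋_∶_ _⊢[_]_∶_

data _∋_∶_ {A : Set} : List A → ℕ → A → Set where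
  here  : ∀ {σ B} → (σ ∷ B) ∋ zero ∶ σ
  there : ∀ {σ τ B i} → B ∋ i ∶ σ → (τ ∷ B) ∋ suc i ∶ σ

data _⊢[_]_∶_ {T : Theory} (B : List (Type T)) (R : Rel) : ΔTerm T → Type T → Set where
  top : ∀ ⦃ h : HasΩ T ⦄ {Δ} → B ⊢[ R ] u Δ ∶ ω
  ax  : ∀ {i σ} → B ∋ i ∶ σ → B ⊢[ R ] var i ∶ σ
  →I  : ∀ {σ τ Δ} → _⊢[_]_∶_ (σ ∷ B) R Δ τ → B ⊢[ R ] lam σ Δ ∶ σ ⇒ τ
  →E  : ∀ {σ τ Δ₁ Δ₂} → B ⊢[ R ] Δ₁ ∶ σ ⇒ τ → B ⊢[ R ] Δ₂ ∶ σ →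
        B ⊢[ R ] Δ₁ · Δ₂ ∶ τ
  ∩I  : ∀ {σ τ Δ₁ Δ₂} → B ⊢[ R ] Δ₁ ∶ σ → B ⊢[ R ] Δ₂ ∶ τ →
        ⟦ R ⟧R ⌊ Δ₁ ⌋ ⌊ Δ₂ ⌋ → B ⊢[ R ] ⟨ Δ₁ , Δ₂ ⟩ ∶ σ ∩ τ
  ∩E₁ : ∀ {σ τ Δ} → B ⊢[ R ] Δ ∶ σ ∩ τ → B ⊢[ R ] pr₁ Δ ∶ σ
  ∩E₂ : ∀ {σ τ Δ} → B ⊢[ R ] Δ ∶ σ ∩ τ → B ⊢[ R ] pr₂ Δ ∶ τ
  ≤T  : ∀ {σ τ Δ} → B ⊢[ R ] Δ ∶ σ → T ⊢ σ ≤ τ → B ⊢[ R ] Δ ^ τ ∶ τ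

-- Every strongly normalising term is typable in the Curry-style system of
-- strict intersection types without ω: by induction on strong normalisation,
-- a head redex is typed by subject expansion from its contractum together with
-- a typing of its argument (which is strongly normalising and so typable even
-- if it is erased), while λ-abstractions and neutral terms var i N₁ … Nₖ are
-- typed directly from typings of their subterms.  A Curry derivation is then
-- decorated into a Δ-term: an occurrence of a variable of type a₁ ∩ … ∩ aₙ is
-- selected by projections, and an argument typed at several types becomes a
-- tuple of Δ-terms which all have that argument as essence, so the side
-- condition of (∩I) is reflexivity of R.

module Submission where

open import Defs
open import Data.List using (List; []; _∷_; _++_; _∷ʳ_; foldl; applyUpTo)
open import Data.List.NonEmpty using (List⁺; _∷_; toList)
open import Data.List.Membership.Propositional using (_∈_)
open import Data.List.Membership.Propositional.Properties using (∈-++⁺ˡ; ∈-++⁺ʳ)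
open import Data.List.Properties using (foldl-∷ʳ)
open import Data.List.Relation.Unary.All as All using (All; []; _∷_)
open import Data.List.Relation.Unary.All.Properties using (++⁺)
open import Data.List.Relation.Unary.Any using (here; there)
open import Data.Nat using (ℕ; zero; suc; _≤_; _<_; _⊔_; _+_; s≤s; _<?_)
open import Data.Nat.Induction using (<-wellFounded)
open import Data.Nat.Properties as ℕₚ
  using (m≤n⇒m≤1+n; m≤m⊔n; m≤n⊔m; m≤m+n; m≤n+m; <-≤-trans; ≮⇒≥)
open import Data.Product using (∃; _×_; ∃-syntax; _,_)
open import Function using (_∘_)
open import Induction.WellFounded using (Acc; acc)
open import Relation.Nullary using (yes; no)
open import Relation.Binary.PropositionalEquality
  using (_≡_; refl; cong; cong₂) renaming (sym to ≡-sym; trans to ≡-trans; subst to ≡-subst)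

infixr 6 _⟶_

data SType : Set where
  o   : SType
  _⟶_ : List⁺ SType → SType → SType

Ctx : Set
Ctx = ℕ → List SType

infixr 5 _∷ᶜ_

_∷ᶜ_ : List SType → Ctx → Ctx
(A ∷ᶜ Γ) zero    = A
(A ∷ᶜ Γ) (suc i) = Γ i

∅ : Ctx
∅ _ = []

_∪ᶜ_ : Ctx → Ctx → Ctx
(Γ ∪ᶜ Δ) i = Γ i ++ Δ i

infix 4 _⊩_∶_ _⊩*_∶_ _⊩ˢ_∶_ _⊆ᶜ_

data _⊩_∶_ (Γ : Ctx) : Λ → SType → Set where
  ⊩var : ∀ {i a} → a ∈ Γ i → Γ ⊩ var i ∶ a
  ⊩ƛ   : ∀ {A b M} → toList A ∷ᶜ Γ ⊩ M ∶ b → Γ ⊩ ƛ M ∶ A ⟶ b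
  ⊩·   : ∀ {A b M N} → Γ ⊩ M ∶ A ⟶ b → All (Γ ⊩ N ∶_) (toList A) → Γ ⊩ M · N ∶ b

_⊩*_∶_ : Ctx → Λ → List SType → Set
Γ ⊩* M ∶ A = All (Γ ⊩ M ∶_) A

_⊩ˢ_∶_ : Ctx → (ℕ → Λ) → Ctx → Set
Γ ⊩ˢ s ∶ Δ = ∀ i → Γ ⊩* s i ∶ Δ i

_⊆ᶜ_ : Ctx → Ctx → Set
Γ ⊆ᶜ Δ = ∀ i {a} → a ∈ Γ i → a ∈ Δ i

variable
  Γ Δ : Ctx
  H H' K M M' N P : Λ
  a b c : SType
  A : List SType

⊆ᶜ-∪ˡ : Γ ⊆ᶜ Γ ∪ᶜ Δ
⊆ᶜ-∪ˡ i = ∈-++⁺ˡ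

⊆ᶜ-∪ʳ : Δ ⊆ᶜ Γ ∪ᶜ Δ
⊆ᶜ-∪ʳ {Γ = Γ} i = ∈-++⁺ʳ (Γ i)

⊆ᶜ-∷ᶜ : Γ ⊆ᶜ Δ → A ∷ᶜ Γ ⊆ᶜ A ∷ᶜ Δ
⊆ᶜ-∷ᶜ Γ⊆Δ zero    = λ a∈A → a∈A
⊆ᶜ-∷ᶜ Γ⊆Δ (suc i) = Γ⊆Δ i

mutual
  weaken : Γ ⊆ᶜ Δ → Γ ⊩ M ∶ a → Δ ⊩ M ∶ a
  weaken Γ⊆Δ (⊩var a∈Γi) = ⊩var (Γ⊆Δ _ a∈Γi)
  weaken Γ⊆Δ (⊩ƛ d)      = ⊩ƛ (weaken (⊆ᶜ-∷ᶜ Γ⊆Δ) d)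
  weaken Γ⊆Δ (⊩· d ds)   = ⊩· (weaken Γ⊆Δ d) (weaken* Γ⊆Δ ds)

  weaken* : Γ ⊆ᶜ Δ → Γ ⊩* M ∶ A → Δ ⊩* M ∶ A
  weaken* Γ⊆Δ []       = []
  weaken* Γ⊆Δ (d ∷ ds) = weaken Γ⊆Δ d ∷ weaken* Γ⊆Δ ds

var-inv* : ∀ {i} → Γ ⊩* var i ∶ A → a ∈ A → a ∈ Γ i
var-inv* ds a∈A with All.lookup ds a∈A
... | ⊩var a∈Γi = a∈Γi

mutual
  rename-inv : ∀ ρ M → Γ ⊩ rename ρ M ∶ a → Γ ∘ ρ ⊩ M ∶ a
  rename-inv ρ (var i) (⊩var a∈Γρi) = ⊩var a∈Γρi
  rename-inv {Γ = Γ} ρ (ƛ M) (⊩ƛ {A = A} d) = ⊩ƛ (weaken ext-comm (rename-inv (ext ρ) M d))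
    where
    ext-comm : (toList A ∷ᶜ Γ) ∘ ext ρ ⊆ᶜ toList A ∷ᶜ Γ ∘ ρ
    ext-comm zero    = λ a∈A → a∈A
    ext-comm (suc i) = λ a∈Γρi → a∈Γρi
  rename-inv ρ (M · N) (⊩· d ds) = ⊩· (rename-inv ρ M d) (rename-inv* ρ N ds)

  rename-inv* : ∀ ρ M → Γ ⊩* rename ρ M ∶ A → Γ ∘ ρ ⊩* M ∶ A
  rename-inv* ρ M []       = []
  rename-inv* ρ M (d ∷ ds) = rename-inv ρ M d ∷ rename-inv* ρ M ds

singleton : ℕ → SType → Ctx
singleton zero    b = (b ∷ []) ∷ᶜ ∅
singleton (suc i) b = [] ∷ᶜ singleton i b

∈-singleton : ∀ i → b ∈ singleton i b i
∈-singleton zero    = here refl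
∈-singleton (suc i) = ∈-singleton i

⊩ˢ-singleton : ∀ s i → Γ ⊩ s i ∶ b → Γ ⊩ˢ s ∶ singleton i b
⊩ˢ-singleton s zero    d zero    = d ∷ []
⊩ˢ-singleton s zero    d (suc j) = []
⊩ˢ-singleton s (suc i) d zero    = []
⊩ˢ-singleton s (suc i) d (suc j) = ⊩ˢ-singleton (s ∘ suc) i d j

⊩ˢ-∪ᶜ : ∀ {s Δ₁ Δ₂} → Γ ⊩ˢ s ∶ Δ₁ → Γ ⊩ˢ s ∶ Δ₂ → Γ ⊩ˢ s ∶ Δ₁ ∪ᶜ Δ₂
⊩ˢ-∪ᶜ ds₁ ds₂ i = ++⁺ (ds₁ i) (ds₂ i)

mutual
  subst-inv : ∀ s P → Γ ⊩ subst s P ∶ b → ∃[ Δ ] Δ ⊩ P ∶ b × Γ ⊩ˢ s ∶ Δ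
  subst-inv s (var i) d = singleton i _ , ⊩var (∈-singleton i) , ⊩ˢ-singleton s i d
  subst-inv {Γ = Γ} s (ƛ P) (⊩ƛ {A = A} d) with subst-inv (exts s) P d
  ... | Δ , dP , ds = Δ ∘ suc , ⊩ƛ (weaken Δ⊆ dP) , rename-inv* suc _ ∘ ds ∘ suc
    where
    Δ⊆ : Δ ⊆ᶜ toList A ∷ᶜ Δ ∘ suc
    Δ⊆ zero    = var-inv* (ds zero)
    Δ⊆ (suc i) = λ a∈Δi → a∈Δi
  subst-inv s (P · Q) (⊩· d ds) with subst-inv s P d | subst-inv* s Q ds
  ... | Δ₁ , dP , ds₁ | Δ₂ , dQ , ds₂ =
    Δ₁ ∪ᶜ Δ₂ , ⊩· (weaken ⊆ᶜ-∪ˡ dP) (weaken* (⊆ᶜ-∪ʳ {Γ = Δ₁}) dQ) , ⊩ˢ-∪ᶜ ds₁ ds₂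

  subst-inv* : ∀ s P → Γ ⊩* subst s P ∶ A → ∃[ Δ ] Δ ⊩* P ∶ A × Γ ⊩ˢ s ∶ Δ
  subst-inv* s P [] = ∅ , [] , λ _ → []
  subst-inv* s P (d ∷ ds) with subst-inv s P d | subst-inv* s P ds
  ... | Δ₁ , dP , ds₁ | Δ₂ , dPs , ds₂ =
    Δ₁ ∪ᶜ Δ₂ , weaken ⊆ᶜ-∪ˡ dP ∷ weaken* (⊆ᶜ-∪ʳ {Γ = Δ₁}) dPs , ⊩ˢ-∪ᶜ ds₁ ds₂

-- The typing of N at c keeps the abstracted variable's list of types
-- nonempty when it does not occur in P.
β-expansion : Γ ⊩ P [ N ] ∶ b → Γ ⊩ N ∶ c → Γ ⊩ (ƛ P) · N ∶ b
β-expansion {Γ = Γ} {P = P} {N = N} {c = c} d dN with subst-inv (subst-zero N) P d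
... | Δ , dP , ds = ⊩· (⊩ƛ (weaken Δ⊆ dP)) (dN ∷ ds zero)
  where
  Δ⊆ : Δ ⊆ᶜ (c ∷ Δ zero) ∷ᶜ Γ
  Δ⊆ zero    = there
  Δ⊆ (suc i) = var-inv* (ds (suc i))

infixl 7 _·*_

_·*_ : Λ → List Λ → Λ
_·*_ = foldl _·_

head-expansion : ∀ Ns → (∀ {b} → Γ ⊩ H' ∶ b → Γ ⊩ H ∶ b) → Γ ⊩ H' ·* Ns ∶ b → Γ ⊩ H ·* Ns ∶ b
head-expansion []       expand d = expand d
head-expansion (N ∷ Ns) expand d =
  head-expansion Ns (λ { (⊩· dH' dN) → ⊩· (expand dH') dN }) d

Supported : Ctx → ℕ → Set
Supported Γ n = ∀ i → n ≤ i → Γ i ≡ []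

∪ᶜ-supported : ∀ {m n} → Supported Γ m → Supported Δ n → Supported (Γ ∪ᶜ Δ) (m ⊔ n)
∪ᶜ-supported {m = m} {n} sΓ sΔ i m⊔n≤i
  rewrite sΓ i (ℕₚ.≤-trans (m≤m⊔n m n) m⊔n≤i) | sΔ i (ℕₚ.≤-trans (m≤n⊔m m n) m⊔n≤i) = refl

record Typing (M : Λ) (a : SType) : Set where
  constructor typing
  field
    ctx        : Ctx
    bound      : ℕ
    supported  : Supported ctx bound
    derivation : ctx ⊩ M ∶ a

Typable : Λ → Set
Typable M = ∃ (Typing M)

merge : Typing M a → Typing N b → (∀ {Γ} → Γ ⊩ M ∶ a → Γ ⊩ N ∶ b → Γ ⊩ K ∶ c) → Typing K c
merge (typing Γ m sΓ d) (typing Δ n sΔ e) rule =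
  typing (Γ ∪ᶜ Δ) (m ⊔ n) (∪ᶜ-supported sΓ sΔ) (rule (weaken ⊆ᶜ-∪ˡ d) (weaken (⊆ᶜ-∪ʳ {Γ = Γ}) e))

ƛ-typable : Typable P → Typable (ƛ P)
ƛ-typable (a , typing Γ n sΓ d) =
  (o ∷ Γ zero) ⟶ a ,
  typing (Γ ∘ suc) n (λ i n≤i → sΓ (suc i) (m≤n⇒m≤1+n n≤i)) (⊩ƛ (weaken Γ⊆ d))
  where
  Γ⊆ : Γ ⊆ᶜ (o ∷ Γ zero) ∷ᶜ Γ ∘ suc
  Γ⊆ zero    = there
  Γ⊆ (suc i) = λ a∈Γi → a∈Γi

var-typing : ∀ i → Typing (var i) b
var-typing i = typing (singleton i _) (suc i) (singleton-supported i) (⊩var (∈-singleton i))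
  where
  singleton-supported : ∀ i → Supported (singleton i b) (suc i)
  singleton-supported zero    (suc j) _         = refl
  singleton-supported (suc i) (suc j) (s≤s i≤j) = singleton-supported i j i≤j

·*-typing : ∀ {Ns} → (∀ b → Typing H b) → All Typable Ns → ∀ b → Typing (H ·* Ns) b
·*-typing tH []              = tH
·*-typing tH ((a , tN) ∷ tNs) =
  ·*-typing (λ b → merge (tH ((a ∷ []) ⟶ b)) tN (λ dH dN → ⊩· dH (dN ∷ []))) tNs

redex-typable : ∀ Ns → Typable (P [ N ] ·* Ns) → Typable N → Typable ((ƛ P) · N ·* Ns)
redex-typable Ns (b , tContractum) (c , tN) =
  b , merge tContractum tN (λ d dN → head-expansion Ns (λ d' → β-expansion d' dN) d)

data HeadForm : Λ → Set where
  abs     : ∀ P → HeadForm (ƛ P)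
  neutral : ∀ i Ns → HeadForm (var i ·* Ns)
  redex   : ∀ P N Ns → HeadForm ((ƛ P) · N ·* Ns)

headForm : ∀ M → HeadForm M
headForm (var i) = neutral i []
headForm (ƛ P)   = abs P
headForm (M · N) with headForm M
... | abs P        = redex P N []
... | neutral i Ns = ≡-subst HeadForm (foldl-∷ʳ _·_ (var i) N Ns) (neutral i (Ns ∷ʳ N))
... | redex P Q Ns = ≡-subst HeadForm (foldl-∷ʳ _·_ ((ƛ P) · Q) N Ns) (redex P Q (Ns ∷ʳ N))

size : Λ → ℕ
size (var _) = 1
size (ƛ P)   = suc (size P)
size (P · Q) = suc (size P + size Q)

size-·*-head : ∀ Ns → size H ≤ size (H ·* Ns)
size-·*-head              []       = ℕₚ.≤-refl
size-·*-head {H = H} (N ∷ Ns) = ℕₚ.≤-trans (m≤n⇒m≤1+n (m≤m+n (size H) (size N))) (size-·*-head Ns)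

size-·*-arg : ∀ Ns → N ∈ Ns → size N < size (H ·* Ns)
size-·*-arg {N = N} {H = H} (N ∷ Ns) (here refl) = <-≤-trans (s≤s (m≤n+m (size N) (size H))) (size-·*-head Ns)
size-·*-arg (_ ∷ Ns) (there N∈Ns) = size-·*-arg Ns N∈Ns

infix 4 _⊴_

data _⊴_ : Λ → Λ → Set where
  ⊴-refl : M ⊴ M
  ⊴-ƛ    : M ⊴ P → M ⊴ ƛ P
  ⊴-·ˡ   : M ⊴ P → M ⊴ P · N
  ⊴-·ʳ   : M ⊴ N → M ⊴ P · N

⊴-trans : M ⊴ K → K ⊴ N → M ⊴ N
⊴-trans M⊴K ⊴-refl      = M⊴K
⊴-trans M⊴K (⊴-ƛ K⊴P)  = ⊴-ƛ (⊴-trans M⊴K K⊴P)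
⊴-trans M⊴K (⊴-·ˡ K⊴P) = ⊴-·ˡ (⊴-trans M⊴K K⊴P)
⊴-trans M⊴K (⊴-·ʳ K⊴N) = ⊴-·ʳ (⊴-trans M⊴K K⊴N)

⊴-·*-head : ∀ Ns → H ⊴ H ·* Ns
⊴-·*-head []       = ⊴-refl
⊴-·*-head (N ∷ Ns) = ⊴-trans (⊴-·ˡ ⊴-refl) (⊴-·*-head Ns)

⊴-·*-arg : ∀ Ns → N ∈ Ns → N ⊴ H ·* Ns
⊴-·*-arg (N ∷ Ns) (here refl)  = ⊴-trans (⊴-·ʳ ⊴-refl) (⊴-·*-head Ns)
⊴-·*-arg (_ ∷ Ns) (there N∈Ns) = ⊴-·*-arg Ns N∈Ns

⊴-reduct : M' ⊴ M → M' →β N → ∃[ K ] M →β K × N ⊴ K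
⊴-reduct ⊴-refl M'→N = _ , M'→N , ⊴-refl
⊴-reduct (⊴-ƛ M'⊴P) M'→N with ⊴-reduct M'⊴P M'→N
... | K , P→K , N⊴K = ƛ K , ξ-ƛ P→K , ⊴-ƛ N⊴K
⊴-reduct (⊴-·ˡ {N = Q} M'⊴P) M'→N with ⊴-reduct M'⊴P M'→N
... | K , P→K , N⊴K = K · Q , ξ-·₁ P→K , ⊴-·ˡ N⊴K
⊴-reduct (⊴-·ʳ {P = P} M'⊴Q) M'→N with ⊴-reduct M'⊴Q M'→N
... | K , Q→K , N⊴K = P · K , ξ-·₂ Q→K , ⊴-·ʳ N⊴K

·*-reduct : ∀ Ns → H →β H' → H ·* Ns →β H' ·* Ns
·*-reduct []       H→H' = H→H'
·*-reduct (N ∷ Ns) H→H' = ·*-reduct Ns (ξ-·₁ H→H')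

-- Lexicographic induction: on strong normalisation of the enclosing term M,
-- then on the size of its subterm M'; a head reduction of M' lifts to M.
mutual
  typable-⊴ : SN M → M' ⊴ M → Acc _<_ (size M') → Typable M'
  typable-⊴ sn = typable-headForm sn (headForm _)

  typable-headForm : SN M → HeadForm M' → M' ⊴ M → Acc _<_ (size M') → Typable M'
  typable-headForm sn (abs P) M'⊴M (acc smaller) =
    ƛ-typable (typable-⊴ sn (⊴-trans (⊴-ƛ ⊴-refl) M'⊴M) (smaller ℕₚ.≤-refl))
  typable-headForm sn (neutral i Ns) M'⊴M (acc smaller) =
    o , ·*-typing (λ _ → var-typing i) (All.tabulate λ N∈Ns →
          typable-⊴ sn (⊴-trans (⊴-·*-arg Ns N∈Ns) M'⊴M) (smaller (size-·*-arg Ns N∈Ns))) o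
  typable-headForm sn@(acc reducts) (redex P N Ns) M'⊴M (acc smaller) =
    let K , M→K , contractum⊴K = ⊴-reduct M'⊴M (·*-reduct Ns (β {M = P} {N = N}))
        N∈N∷Ns = here refl
    in redex-typable Ns (typable-⊴ (reducts M→K) contractum⊴K (<-wellFounded _))
                        (typable-⊴ sn (⊴-trans (⊴-·*-arg (N ∷ Ns) N∈N∷Ns) M'⊴M)
                                      (smaller (size-·*-arg (N ∷ Ns) N∈N∷Ns)))

sn⇒typable : SN M → Typable M
sn⇒typable sn = typable-⊴ sn ⊴-refl (<-wellFounded _)

⟦⟧R-reflexive : ∀ R → M ≡ N → ⟦ R ⟧R M N
⟦⟧R-reflexive ≡R  M≡N  = M≡N
⟦⟧R-reflexive βR  refl = refl
⟦⟧R-reflexive βηR refl = refl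

applyUpTo-∋ : ∀ {X : Set} (f : ℕ → X) {n i} → i < n → applyUpTo f n ∋ i ∶ f i
applyUpTo-∋ f {i = zero}  (s≤s _)   = here
applyUpTo-∋ f {i = suc i} (s≤s i<n) = there (applyUpTo-∋ (f ∘ suc) i<n)

module Decorating (T : Theory) (R : Rel) where

  Decoration : List (Type T) → Λ → Type T → Set
  Decoration B M σ = ∃[ Δ ] ⌊ Δ ⌋ ≡ M × B ⊢[ R ] Δ ∶ σ

  mutual
    ⟦_⟧ : SType → Type T
    ⟦ o ⟧     = atom 0
    ⟦ A ⟶ b ⟧ = ⋂⁺ A ⇒ ⟦ b ⟧

    ⋂⁺ : List⁺ SType → Type T
    ⋂⁺ (a ∷ A) = ⋂′ a A

    ⋂′ : SType → List SType → Type T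
    ⋂′ a []       = ⟦ a ⟧
    ⋂′ a (b ∷ A) = ⟦ a ⟧ ∩ ⋂′ b A

  -- The empty intersection is junk: it only types variables the derivation never uses.
  ⋂ : List SType → Type T
  ⋂ []      = atom 0
  ⋂ (a ∷ A) = ⋂′ a A

  data Conjunct : Type T → Type T → Set where
    whole : ∀ {σ} → Conjunct σ σ
    left  : ∀ {σ τ ρ} → Conjunct σ ρ → Conjunct (σ ∩ τ) ρ
    right : ∀ {σ τ ρ} → Conjunct τ ρ → Conjunct (σ ∩ τ) ρ

  conjunct-⋂′ : ∀ a A → c ∈ a ∷ A → Conjunct (⋂′ a A) ⟦ c ⟧
  conjunct-⋂′ a []      (here refl) = whole
  conjunct-⋂′ a (b ∷ A) (here refl) = left whole
  conjunct-⋂′ a (b ∷ A) (there c∈A) = right (conjunct-⋂′ b A c∈A)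

  conjunct-⋂ : c ∈ A → Conjunct (⋂ A) ⟦ c ⟧
  conjunct-⋂ {A = a ∷ A} = conjunct-⋂′ a A

  project : ∀ {B σ τ} → Conjunct σ τ → Decoration B M σ → Decoration B M τ
  project whole       dec                = dec
  project (left  pth) (Δ , ⌊Δ⌋≡M , d) = project pth (pr₁ Δ , ⌊Δ⌋≡M , ∩E₁ d)
  project (right pth) (Δ , ⌊Δ⌋≡M , d) = project pth (pr₂ Δ , ⌊Δ⌋≡M , ∩E₂ d)

  Realises : List (Type T) → Ctx → Set
  Realises B Γ = ∀ i {c} → c ∈ Γ i → B ∋ i ∶ ⋂ (Γ i)

  realises-∷ : ∀ {B} A → Realises B Γ → Realises (⋂⁺ A ∷ B) (toList A ∷ᶜ Γ)
  realises-∷ (a ∷ A) ρ zero    _    = here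
  realises-∷ (a ∷ A) ρ (suc i) c∈Γi = there (ρ i c∈Γi)

  mutual
    decorate : ∀ {B} → Realises B Γ → Γ ⊩ M ∶ a → Decoration B M ⟦ a ⟧
    decorate ρ (⊩var {i} c∈Γi) = project (conjunct-⋂ c∈Γi) (var i , refl , ax (ρ i c∈Γi))
    decorate ρ (⊩ƛ {A = A} d) with decorate (realises-∷ A ρ) d
    ... | Δ , ⌊Δ⌋≡M , d′ = lam (⋂⁺ A) Δ , cong ƛ_ ⌊Δ⌋≡M , →I d′
    decorate ρ (⊩· {A = a ∷ A} d ds) with decorate ρ d | decorate* ρ a A ds
    ... | Δ₁ , ⌊Δ₁⌋≡M , d₁ | Δ₂ , ⌊Δ₂⌋≡N , d₂ = Δ₁ · Δ₂ , cong₂ _·_ ⌊Δ₁⌋≡M ⌊Δ₂⌋≡N , →E d₁ d₂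

    decorate* : ∀ {B} → Realises B Γ → ∀ a A → Γ ⊩* N ∶ a ∷ A → Decoration B N (⋂′ a A)
    decorate* ρ a []      (d ∷ []) = decorate ρ d
    decorate* ρ a (b ∷ A) (d ∷ ds) with decorate ρ d | decorate* ρ b A ds
    ... | Δ₁ , ⌊Δ₁⌋≡N , d₁ | Δ₂ , ⌊Δ₂⌋≡N , d₂ =
      ⟨ Δ₁ , Δ₂ ⟩ , ⌊Δ₁⌋≡N , ∩I d₁ d₂ (⟦⟧R-reflexive R (≡-trans ⌊Δ₁⌋≡N (≡-sym ⌊Δ₂⌋≡N)))

  basis : Ctx → ℕ → List (Type T)
  basis Γ = applyUpTo (⋂ ∘ Γ)

  basis-realises : ∀ {n} → Supported Γ n → Realises (basis Γ n) Γ
  basis-realises {Γ} {n} supp i c∈Γi with i <? n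
  ... | yes i<n = applyUpTo-∋ (⋂ ∘ Γ) i<n
  ... | no  i≮n with ≡-subst (_ ∈_) (supp i (≮⇒≥ i≮n)) c∈Γi
  ...   | ()

  typable⇒decoration : Typable M → ∃[ B ] ∃[ σ ] Decoration B M σ
  typable⇒decoration (a , typing Γ n supp d) = basis Γ n , ⟦ a ⟧ , decorate (basis-realises supp) d

-- The hypothesis System T R is unused: the decoration needs only the rules of
-- the minimal type theory and the reflexivity of R.
theorem5p3 : (T : Theory) (R : Rel) → System T R →
             (M : Λ) → SN M →
             ∃[ B ] ∃[ σ ] ∃[ Δ ] (⌊ Δ ⌋ ≡ M × _⊢[_]_∶_ {T} B R Δ σ)
theorem5p3 T R _ M sn = Decorating.typable⇒decoration T R (sn⇒typable sn)
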